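{- Let $S$ be a numerical semigroup and let $a,x,y\in S^*$. Then $\lambda(x+y)>\max\{\lambda(x),\lambda(y)\}$. Moreover, if $\lambda(a+x)=\lambda(a+y)$, then $|\lambda(y)-\lambda(x)|\le 1$.
   Context: A numerical semigroup is a submonoid $S$ of $(\mathbb N,+)$ with $\mathbb N\setminus S$ finite; $S^*=S\setminus\{0\}$, $m=\min S^*$, $c$ is the least $c\in\mathbb N$ with $[c,\infty[\subseteq S$, $q=\lceil c/m\rceil$, $\rho=qm-c\in[0,m-1]$. The level function $\lambda:\mathbb N\to\mathbb N$ is defined by $\lambda(x)=j$ iff $jm-\rho\le x\le (j+1)m-\rho-1$. -}

module Defs where

open import Data.Nat using (ℕ; _+_; _*_; _∸_; _≤_; _<_)
import Data.Nat as N
open import Data.Product using (_×_; ∃-syntax)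

-- A numerical semigroup: a submonoid of (ℕ,+) with finite complement
-- (finite complement <=> all sufficiently large naturals belong to S).
record NumericalSemigroup : Set₁ where
  field
    _∈S      : ℕ → Set
    0∈S      : 0 ∈S
    +-closed : ∀ {x y} → x ∈S → y ∈S → (x + y) ∈S
    cofinite : ∃[ N ] (∀ n → N ≤ n → n ∈S)

  _∈S* : ℕ → Set
  x ∈S* = x ∈S × 0 < x

open NumericalSemigroup public

IsMultiplicity : NumericalSemigroup → ℕ → Set
IsMultiplicity S m = _∈S* S m × (∀ s → _∈S* S s → m ≤ s)

IsConductor : NumericalSemigroup → ℕ → Set
IsConductor S c =
  (∀ n → c ≤ n → _∈S S n) × (∀ d → (∀ n → d ≤ n → _∈S S n) → c ≤ d)

IsCeilDiv : ℕ → ℕ → ℕ → Set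
IsCeilDiv c m q = c ≤ q * m × q * m < c + m

rho : ℕ → ℕ → ℕ → ℕ
rho m c q = q * m ∸ c

-- λ(x) = j  iff  j m - ρ ≤ x ≤ (j+1) m - ρ - 1,
-- written in ℕ (adding ρ to all sides) as  j m ≤ x + ρ < (j+1) m,
-- with q = ⌈c/m⌉ and ρ = q m - c.
IsLevel : (m c x j : ℕ) → Set
IsLevel m c x j =
  ∃[ q ] (IsCeilDiv c m q × j * m ≤ x + rho m c q × x + rho m c q < N.suc j * m)

module Submission where

-- Since q = ⌈c/m⌉ is unique, every level is computed with the same ρ, so λ(x)
-- is the block index ⌊(x + ρ)/m⌋. A gap of at least m between two arguments
-- raises the block index, which gives the first claim as m ≤ x, y. Conversely,
-- block indices two apart force a gap of at least m between x and y, which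
-- survives translation by a and separates λ(a + x) from λ(a + y).

open import Defs
open import Data.Nat using (ℕ; zero; suc; _+_; _*_; _≤_; _<_; _⊔_; ∣_-_∣; z≤n; s≤s)
open import Data.Nat.Properties
open import Algebra.Properties.CommutativeSemigroup +-commutativeSemigroup using (xy∙z≈xz∙y)
open import Data.Product using (_×_; _,_)
open import Relation.Binary.PropositionalEquality using (_≡_; refl; sym; subst)

record IsBlockIndex (m n j : ℕ) : Set where
  constructor _,_
  field
    lower : j * m ≤ n
    upper : n < suc j * m

private
  variable
    m c i j k : ℕ

ceilDiv-≤ : ∀ q q′ → IsCeilDiv c m q → IsCeilDiv c m q′ → q ≤ q′
ceilDiv-≤ {c} {m} q q′ (_ , qm<c+m) (c≤q′m , _) =
  ≤-pred (*-cancelʳ-< m q (suc q′) (begin-strict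
    q * m      <⟨ qm<c+m ⟩
    c + m      ≤⟨ +-monoˡ-≤ m c≤q′m ⟩
    q′ * m + m ≡⟨ +-comm (q′ * m) m ⟩
    suc q′ * m ∎))
  where open ≤-Reasoning

ceilDiv-unique : ∀ q q′ → IsCeilDiv c m q → IsCeilDiv c m q′ → q ≡ q′
ceilDiv-unique q q′ d d′ = ≤-antisym (ceilDiv-≤ q q′ d d′) (ceilDiv-≤ q′ q d′ d)

level⇒blockIndex : ∀ q x j → IsCeilDiv c m q → IsLevel m c x j
                 → IsBlockIndex m (x + rho m c q) j
level⇒blockIndex {c} {m} q x j d (q′ , d′ , lower , upper) =
  subst (λ r → IsBlockIndex m (x + rho m c r) j) (ceilDiv-unique q′ q d′ d) (lower , upper)

blockIndex-<-of-gap : ∀ {A B} → IsBlockIndex m A i → IsBlockIndex m B k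
                    → A + m ≤ B → i < k
blockIndex-<-of-gap {m} {i} {k} {A} {B} (im≤A , _) (_ , B<) A+m≤B =
  ≤-pred (*-cancelʳ-< m (suc i) (suc k) (begin-strict
    suc i * m ≡⟨ +-comm m (i * m) ⟩
    i * m + m ≤⟨ +-monoˡ-≤ m im≤A ⟩
    A + m     ≤⟨ A+m≤B ⟩
    B         <⟨ B< ⟩
    suc k * m ∎))
  where open ≤-Reasoning

gap-of-blockIndex-< : ∀ {A B} → IsBlockIndex m A i → IsBlockIndex m B j
                    → suc i < j → A + m ≤ B
gap-of-blockIndex-< {m} {i} {j} {A} {B} (_ , A<) (jm≤B , _) 2+i≤j = begin
  A + m           ≤⟨ +-monoˡ-≤ m (<⇒≤ A<) ⟩
  suc i * m + m   ≡⟨ +-comm (suc i * m) m ⟩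
  suc (suc i) * m ≤⟨ *-monoˡ-≤ m 2+i≤j ⟩
  j * m           ≤⟨ jm≤B ⟩
  B               ∎
  where open ≤-Reasoning

gap-+ʳ : ∀ m x y ρ → x + m ≤ y → x + ρ + m ≤ y + ρ
gap-+ʳ m x y ρ gap = subst (_≤ y + ρ) (xy∙z≈xz∙y x m ρ) (+-monoˡ-≤ ρ gap)

gap-cancel-+ʳ : ∀ m x y ρ → x + ρ + m ≤ y + ρ → x + m ≤ y
gap-cancel-+ʳ m x y ρ gap =
  +-cancelʳ-≤ ρ (x + m) y (subst (_≤ y + ρ) (sym (xy∙z≈xz∙y x m ρ)) gap)

gap-+ˡ : ∀ m x y a → x + m ≤ y → a + x + m ≤ a + y
gap-+ˡ m x y a gap = subst (_≤ a + y) (sym (+-assoc a x m)) (+-monoʳ-≤ a gap)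

level-<-of-gap : ∀ x y i k → IsLevel m c x i → IsLevel m c y k → x + m ≤ y → i < k
level-<-of-gap {m} x y i k lx@(q , d , _) ly gap =
  blockIndex-<-of-gap (level⇒blockIndex q x i d lx) (level⇒blockIndex q y k d ly)
                      (gap-+ʳ m x y _ gap)

gap-of-level-< : ∀ x y i j → IsLevel m c x i → IsLevel m c y j → suc i < j → x + m ≤ y
gap-of-level-< {m} x y i j lx@(q , d , _) ly 2+i≤j =
  gap-cancel-+ʳ m x y _
    (gap-of-blockIndex-< (level⇒blockIndex q x i d lx) (level⇒blockIndex q y j d ly) 2+i≤j)

∣-∣≤1 : j ≤ suc i → i ≤ suc j → ∣ j - i ∣ ≤ 1
∣-∣≤1 {zero}        {zero}        _       _       = z≤n
∣-∣≤1 {suc zero}    {zero}        _       _       = s≤s z≤n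
∣-∣≤1 {zero}        {suc zero}    _       _       = s≤s z≤n
∣-∣≤1 {suc (suc j)} {zero}        (s≤s ()) _
∣-∣≤1 {zero}        {suc (suc i)} _       (s≤s ())
∣-∣≤1 {suc j}       {suc i}       (s≤s p) (s≤s q) = ∣-∣≤1 p q

level-of-translates-≡⇒≤suc : ∀ a x y i j k → IsLevel m c x i → IsLevel m c y j
                           → IsLevel m c (a + x) k → IsLevel m c (a + y) k → j ≤ suc i
level-of-translates-≡⇒≤suc {m} a x y i j k lx ly lax lay = ≮⇒≥ λ 2+i≤j →
  <-irrefl refl (level-<-of-gap (a + x) (a + y) k k lax lay
                  (gap-+ˡ m x y a (gap-of-level-< x y i j lx ly 2+i≤j)))

corollary2p5 : (S : NumericalSemigroup) (m c : ℕ)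
    → IsMultiplicity S m → IsConductor S c
    → (a x y : ℕ) → _∈S* S a → _∈S* S x → _∈S* S y
    → (∀ i j k → IsLevel m c x i → IsLevel m c y j → IsLevel m c (x + y) k
         → i ⊔ j < k)
      × (∀ i j k l → IsLevel m c x i → IsLevel m c y j
         → IsLevel m c (a + x) k → IsLevel m c (a + y) l → k ≡ l
         → ∣ j - i ∣ ≤ 1)
corollary2p5 S m c (_ , minimal) _ a x y _ x∈S* y∈S* =
  (λ i j k lx ly lxy →
     ⊔-lub (level-<-of-gap x (x + y) i k lx lxy x+m≤x+y)
           (level-<-of-gap y (x + y) j k ly lxy y+m≤x+y)) ,
  (λ { i j k .k lx ly lax lay refl →
     ∣-∣≤1 (level-of-translates-≡⇒≤suc a x y i j k lx ly lax lay)
           (level-of-translates-≡⇒≤suc a y x j i k ly lx lay lax) })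
  where
  x+m≤x+y : x + m ≤ x + y
  x+m≤x+y = +-monoʳ-≤ x (minimal y y∈S*)

  y+m≤x+y : y + m ≤ x + y
  y+m≤x+y = subst (y + m ≤_) (+-comm y x) (+-monoʳ-≤ y (minimal x x∈S*))
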